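{- Let $f:2^V\to\mathbb{R}$ be non-decreasing, let $p_i\in[0,1]$ for $i\in V$, let $\{n_i\ge1\}_{i\in V}$ be integers and let $(f',V',\{p'_j\})$ be the instance obtained by splitting. Then $\mathcal{I}(f,V,\{p_i\})\ge\mathcal{I}(f',V',\{p'_j\})$.
   Context: Split operation: each $i\in V$ is replaced by $n_i$ copies $C^i_1,\dots,C^i_{n_i}$, each with marginal probability $p'_{C^i_k}=p_i/n_i$; $V'$ is the set of all copies. For $S'\subseteq V'$ let $\Pi(S')=\{i\in V: C^i_k\in S'\text{ for some }k\}$ and $f'(S')=f(\Pi(S'))$. For a ground set $W$, $h:2^W\to\mathbb{R}$ and marginals $\{q_w\}$, $\mathcal{I}(h,W,\{q_w\})=\mathbb{E}[h(S)]$ where each $w\in W$ is included in $S$ independently with probability $q_w$.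
   Formalization: The values of f and the marginal probabilities $p_i$ are rational rather than real. -}

module Defs where

open import Data.Bool using (Bool; true; false; if_then_else_; _∨_)
open import Data.Nat as ℕ using (ℕ)
open import Data.Integer using (+_)
open import Data.Fin using (Fin)
open import Data.Fin.Properties using () renaming (_≟_ to _≟F_)
open import Data.List using (List; []; _∷_; concatMap; map; foldr)
open import Data.List using () renaming (allFin to allFinL)
open import Data.Product using (Σ; _,_; Σ-syntax)
open import Data.Product.Properties using (≡-dec)
open import Data.Rational using (ℚ; _+_; _*_; _-_; 1ℚ; 0ℚ; _≤_; _/_)
open import Relation.Binary.Definitions using (DecidableEquality)
open import Relation.Binary.PropositionalEquality using (_≡_)
open import Relation.Nullary.Decidable using (⌊_⌋)

Subset : Set → Set
Subset W = W → Bool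

setAt : {W : Set} → DecidableEquality W → Subset W → W → Bool → Subset W
setAt _≟_ S w b x = if ⌊ x ≟ w ⌋ then b else S x

-- I(h, W, {q_w}) = E[h(S)], each w of the ground set W (given by a
-- duplicate-free complete enumeration ws) included independently with
-- probability q w.
I' : {W : Set} → DecidableEquality W → List W → (Subset W → ℚ) → (W → ℚ) → ℚ
I' _≟_ [] h q = h (λ _ → false)
I' _≟_ (w ∷ ws) h q =
  q w * I' _≟_ ws (λ S → h (setAt _≟_ S w true)) q
  + (1ℚ - q w) * I' _≟_ ws (λ S → h (setAt _≟_ S w false)) q

IV : (m : ℕ) → (Subset (Fin m) → ℚ) → (Fin m → ℚ) → ℚ
IV m = I' _≟F_ (allFinL m)

-- Split ground set V' = { C^i_k : i ∈ V, k < n_i }, C^i_k = (i , k).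
V' : (m : ℕ) → (Fin m → ℕ) → Set
V' m n = Σ[ i ∈ Fin m ] Fin (n i)

_≟V'_ : {m : ℕ} {n : Fin m → ℕ} → DecidableEquality (V' m n)
_≟V'_ = ≡-dec _≟F_ _≟F_

allV' : (m : ℕ) (n : Fin m → ℕ) → List (V' m n)
allV' m n = concatMap (λ i → map (λ k → (i , k)) (allFinL (n i))) (allFinL m)

IV' : (m : ℕ) (n : Fin m → ℕ) → (Subset (V' m n) → ℚ) → (V' m n → ℚ) → ℚ
IV' m n = I' _≟V'_ (allV' m n)

anyFin : (k : ℕ) → (Fin k → Bool) → Bool
anyFin k P = foldr _∨_ false (map P (allFinL k))

Π : {m : ℕ} {n : Fin m → ℕ} → Subset (V' m n) → Subset (Fin m)
Π {m} {n} S' i = anyFin (n i) (λ k → S' (i , k))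

splitF : {m : ℕ} (n : Fin m → ℕ) → (Subset (Fin m) → ℚ) → Subset (V' m n) → ℚ
splitF n f S' = f (Π S')

splitP : {m : ℕ} (n : Fin m → ℕ) → (∀ i → 1 ℕ.≤ n i) → (Fin m → ℚ) → V' m n → ℚ
splitP n hn p (i , k) = p i * _/_ (+ 1) (n i) {{ℕ.>-nonZero (hn i)}}

NonDecreasing : {m : ℕ} → (Subset (Fin m) → ℚ) → Set
NonDecreasing {m} f =
  ∀ (S T : Subset (Fin m)) → (∀ i → S i ≡ true → T i ≡ true) → f S ≤ f T

-- Splitting i into n i copies, each present with probability p i / n i, puts i
-- into Π S' with probability at most n i · (p i / n i) = p i (union bound), and
-- monotonicity of f turns this into the inequality.  Elements x are exposed one
-- at a time.  With R c the original expectation over the remaining elements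
-- when x ∈ S iff c, the original side is R false + p x · (R true − R false),
-- and R false ≤ R true.  On the split side a present copy of x bounds the rest
-- by R true, so after k copies the bound is R false + k · (p x / n x) · (R true − R false).
module Submission where

open import Defs
open import Data.Nat using (ℕ)
open import Data.Fin using (Fin)
open import Data.Rational using (ℚ; _≤_; 0ℚ; 1ℚ)

open import Data.Bool using (Bool; true; false; _∨_)
open import Data.Bool.ListAction using (any; or)
open import Data.Empty using (⊥-elim)
open import Data.Fin.Properties using () renaming (_≟_ to _≟F_)
open import Data.Integer as ℤ using (+_)
import Data.Integer.Properties as ℤ
open import Data.List using (List; []; _∷_; map; _++_; length; concatMap; allFin)
open import Data.List.Properties using (map-cong; length-tabulate)
open import Data.Nat as ℕ using (suc)
import Data.Nat.Coprimality as Coprimality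
open import Data.Product using (_,_; proj₁)
open import Data.Rational using (_+_; _*_; _-_; _/_; mkℚ; 1/_; -_; nonNegative)
open import Data.Rational.Properties
open import Data.Rational.Solver using (module +-*-Solver)
open import Data.Sum using (_⊎_; inj₁; inj₂; map₂)
open import Function using (id; _∘_)
open import Relation.Binary.Definitions using (DecidableEquality)
open import Relation.Binary.PropositionalEquality
open import Relation.Nullary using (yes; no; ¬_)
open +-*-Solver

fromℕ : ℕ → ℚ
fromℕ j = mkℚ (+ j) 0 (Coprimality.sym (Coprimality.1-coprimeTo j))

fromℕ-suc : ∀ j → fromℕ (suc j) ≡ 1ℚ + fromℕ j
fromℕ-suc j = sym (trans (cong (λ z → (+ 1 ℤ.+ z) / 1) (ℤ.*-identityʳ (+ j))) (↥p/↧p≡p (fromℕ (suc j))))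

0≤fromℕ : ∀ j → 0ℚ ≤ fromℕ j
0≤fromℕ j = nonNegative⁻¹ (fromℕ j)

p≤q⇒0≤q-p : ∀ {p q} → p ≤ q → 0ℚ ≤ q - p
p≤q⇒0≤q-p {p} {q} p≤q = begin
  0ℚ    ≡⟨ sym (+-inverseʳ p) ⟩
  p - p ≤⟨ +-monoˡ-≤ (- p) p≤q ⟩
  q - p ∎
  where open ≤-Reasoning

0≤p*q : ∀ {p q} → 0ℚ ≤ p → 0ℚ ≤ q → 0ℚ ≤ p * q
0≤p*q {p} {q} 0≤p 0≤q = begin
  0ℚ     ≡⟨ sym (*-zeroʳ p) ⟩
  p * 0ℚ ≤⟨ *-monoˡ-≤-nonNeg p {{nonNegative 0≤p}} 0≤q ⟩
  p * q  ∎
  where open ≤-Reasoning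

p≤p+q : ∀ p {q} → 0ℚ ≤ q → p ≤ p + q
p≤p+q p {q} 0≤q = begin
  p      ≡⟨ sym (+-identityʳ p) ⟩
  p + 0ℚ ≤⟨ +-monoʳ-≤ p 0≤q ⟩
  p + q  ∎
  where open ≤-Reasoning

convex-mono : ∀ {a x x′ y y′} → 0ℚ ≤ a → a ≤ 1ℚ → x ≤ x′ → y ≤ y′
  → a * x + (1ℚ - a) * y ≤ a * x′ + (1ℚ - a) * y′
convex-mono {a} 0≤a a≤1 x≤x′ y≤y′ = +-mono-≤
  (*-monoˡ-≤-nonNeg a {{nonNegative 0≤a}} x≤x′)
  (*-monoˡ-≤-nonNeg (1ℚ - a) {{nonNegative (p≤q⇒0≤q-p a≤1)}} y≤y′)

share : (n : ℕ) .{{_ : ℕ.NonZero n}} → ℚ → ℚ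
share n p = p * (+ 1 / n)

fromℕ*share : ∀ n .{{_ : ℕ.NonZero n}} p → fromℕ n * share n p ≡ p
fromℕ*share (suc k) p = begin
  fromℕ (suc k) * (p * (+ 1 / suc k))      ≡⟨ cong (λ z → fromℕ (suc k) * (p * z)) (↥p/↧p≡p (1/ fromℕ (suc k))) ⟩
  fromℕ (suc k) * (p * 1/ fromℕ (suc k))   ≡⟨ solve 3 (λ a b c → a :* (b :* c) := b :* (a :* c)) refl (fromℕ (suc k)) p (1/ fromℕ (suc k)) ⟩
  p * (fromℕ (suc k) * 1/ fromℕ (suc k))   ≡⟨ cong (p *_) (*-inverseʳ (fromℕ (suc k))) ⟩
  p * 1ℚ                                   ≡⟨ *-identityʳ p ⟩
  p                                        ∎
  where open ≡-Reasoning

0≤share : ∀ n .{{_ : ℕ.NonZero n}} {p} → 0ℚ ≤ p → 0ℚ ≤ share n p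
0≤share n 0≤p = 0≤p*q 0≤p (nonNegative⁻¹ _ {{normalize-nonNeg 1 n}})

share≤1 : ∀ n .{{_ : ℕ.NonZero n}} {p} → 0ℚ ≤ p → p ≤ 1ℚ → share n p ≤ 1ℚ
share≤1 (suc k) {p} 0≤p p≤1 = begin
  share (suc k) p                             ≤⟨ p≤p+q _ (0≤p*q (0≤fromℕ k) (0≤share (suc k) 0≤p)) ⟩
  share (suc k) p + fromℕ k * share (suc k) p ≡⟨ solve 2 (λ s j → s :+ j :* s := (con 1ℚ :+ j) :* s) refl (share (suc k) p) (fromℕ k) ⟩
  (1ℚ + fromℕ k) * share (suc k) p            ≡⟨ cong (_* share (suc k) p) (sym (fromℕ-suc k)) ⟩
  fromℕ (suc k) * share (suc k) p             ≡⟨ fromℕ*share (suc k) p ⟩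
  p                                           ≤⟨ p≤1 ⟩
  1ℚ                                          ∎
  where open ≤-Reasoning

module _ {W : Set} (_≟_ : DecidableEquality W) {q : W → ℚ}
  (0≤q : ∀ w → 0ℚ ≤ q w) (q≤1 : ∀ w → q w ≤ 1ℚ) where

  I'-mono : ∀ ws {h h′ : Subset W → ℚ} → (∀ S → h S ≤ h′ S) → I' _≟_ ws h q ≤ I' _≟_ ws h′ q
  I'-mono []       h≤h′ = h≤h′ _
  I'-mono (w ∷ ws) h≤h′ = convex-mono (0≤q w) (q≤1 w) (I'-mono ws (λ _ → h≤h′ _)) (I'-mono ws (λ _ → h≤h′ _))

_⊆_ : {W : Set} → Subset W → Subset W → Set
S ⊆ T = ∀ w → S w ≡ true → T w ≡ true

module _ {W : Set} (_≟_ : DecidableEquality W) (S : Subset W) (w : W) (b : Bool) where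

  setAt-same : setAt _≟_ S w b w ≡ b
  setAt-same with w ≟ w
  ... | yes _   = refl
  ... | no w≢w = ⊥-elim (w≢w refl)

  setAt-other : ∀ {x} → ¬ x ≡ w → setAt _≟_ S w b x ≡ S x
  setAt-other {x} x≢w with x ≟ w
  ... | yes x≡w = ⊥-elim (x≢w x≡w)
  ... | no _    = refl

  setAt-true : ∀ x → setAt _≟_ S w b x ≡ true → b ≡ true ⊎ S x ≡ true
  setAt-true x Sx with x ≟ w
  ... | yes _ = inj₁ Sx
  ... | no _  = inj₂ Sx

module _ {W : Set} (_≟_ : DecidableEquality W) where

  ⊆-setAt-self : ∀ (S : Subset W) w → S ⊆ setAt _≟_ S w (S w)
  ⊆-setAt-self S w x Sx with x ≟ w
  ... | yes refl = Sx
  ... | no _     = Sx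

  setAt-mono : ∀ {S T : Subset W} {b b′} w → (∀ x → ¬ x ≡ w → S x ≡ true → T x ≡ true) → (b ≡ true → b′ ≡ true)
    → setAt _≟_ S w b ⊆ setAt _≟_ T w b′
  setAt-mono w S⊆T b⇒b′ x Sx with x ≟ w
  ... | yes _   = b⇒b′ Sx
  ... | no x≢w = S⊆T x x≢w Sx

any-false : {A : Set} (xs : List A) → any (λ _ → false) xs ≡ false
any-false []       = refl
any-false (_ ∷ xs) = any-false xs

∨-true : ∀ a {b} → a ∨ b ≡ true → a ≡ true ⊎ b ≡ true
∨-true true  _   = inj₁ refl
∨-true false a∨b = inj₂ a∨b

∨-introˡ : ∀ {a} b → a ≡ true → a ∨ b ≡ true
∨-introˡ _ refl = refl

∨-introʳ : ∀ a {b} → b ≡ true → a ∨ b ≡ true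
∨-introʳ true  _ = refl
∨-introʳ false b = b

any-⊎ : {A : Set} {P Q : A → Bool} {b : Bool} (xs : List A) → (∀ x → P x ≡ true → b ≡ true ⊎ Q x ≡ true)
  → any P xs ≡ true → b ≡ true ⊎ any Q xs ≡ true
any-⊎ {P = P} {Q} (x ∷ xs) P⇒ anyP with ∨-true (P x) anyP
... | inj₁ Px   = map₂ (∨-introˡ (any Q xs)) (P⇒ x Px)
... | inj₂ Pxs  = map₂ (∨-introʳ (Q x)) (any-⊎ xs P⇒ Pxs)

∨-step : ∀ c b {A₁ A₂} → (A₁ ≡ true → b ≡ true ⊎ A₂ ≡ true) → c ∨ (b ∨ A₁) ≡ true → (c ∨ b) ∨ A₂ ≡ true
∨-step true  _     _  _  = refl
∨-step false true  _  _  = refl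
∨-step false false A⇒ A₁ with A⇒ A₁
... | inj₂ A₂ = A₂

module Splitting {m : ℕ} (n : Fin m → ℕ) (hn : ∀ i → 1 ℕ.≤ n i) (p : Fin m → ℚ)
  (0≤p : ∀ i → 0ℚ ≤ p i) (p≤1 : ∀ i → p i ≤ 1ℚ) where

  instance
    n-nonZero : ∀ {i} → ℕ.NonZero (n i)
    n-nonZero {i} = ℕ.>-nonZero (hn i)

  I : List (Fin m) → (Subset (Fin m) → ℚ) → ℚ
  I xs g = I' _≟F_ xs g p

  I′ : List (V' m n) → (Subset (V' m n) → ℚ) → ℚ
  I′ ys H = I' _≟V'_ ys H (splitP n hn p)

  copies : Fin m → List (V' m n)
  copies x = map (x ,_) (allFin (n x))

  Π-setAt-other : ∀ (S : Subset (V' m n)) {x y} k b → ¬ y ≡ x → Π (setAt _≟V'_ S (x , k) b) y ≡ Π S y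
  Π-setAt-other S {x} {y} k b y≢x =
    cong or (map-cong (λ j → setAt-other _≟V'_ S (x , k) b (y≢x ∘ cong proj₁)) (allFin (n y)))

  module Block (g : Subset (Fin m) → ℚ) (g-mono : NonDecreasing g) (x : Fin m) (xs : List (Fin m))
    (L : List (V' m n)) (ih : ∀ g′ → NonDecreasing g′ → ∀ H → (∀ S → H S ≤ g′ (Π S)) → I′ L H ≤ I xs g′) where

    g[x≔_] : Bool → Subset (Fin m) → ℚ
    g[x≔ c ] T = g (setAt _≟F_ T x c)

    g[x≔]-mono : ∀ c → NonDecreasing g[x≔ c ]
    g[x≔]-mono c S T S⊆T = g-mono _ _ (setAt-mono _≟F_ x (λ y _ → S⊆T y) id)

    R : Bool → ℚ
    R c = I xs g[x≔ c ]

    0≤R₁-R₀ : 0ℚ ≤ R true - R false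
    0≤R₁-R₀ = p≤q⇒0≤q-p (I'-mono _≟F_ 0≤p p≤1 xs (λ S → g-mono _ _ (setAt-mono _≟F_ x (λ _ _ → id) (λ ()))))

    u : ℚ
    u = share (n x) (p x)

    0≤u : 0ℚ ≤ u
    0≤u = 0≤share (n x) (0≤p x)

    u≤1 : u ≤ 1ℚ
    u≤1 = share≤1 (n x) (0≤p x) (p≤1 x)

    -- c records whether an already exposed copy of x was present.
    Dominated : Bool → List (Fin (n x)) → (Subset (V' m n) → ℚ) → Set
    Dominated c ks H = ∀ S → H S ≤ g[x≔ c ∨ any (λ k → S (x , k)) ks ] (Π S)

    expose-copy-⊆ : ∀ S k b c ks → let S₁ = setAt _≟V'_ S (x , k) b in
      setAt _≟F_ (Π S₁) x (c ∨ any (λ j → S₁ (x , j)) (k ∷ ks)) ⊆ setAt _≟F_ (Π S) x ((c ∨ b) ∨ any (λ j → S (x , j)) ks)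
    expose-copy-⊆ S k b c ks = setAt-mono _≟F_ x (λ y y≢x → trans (sym (Π-setAt-other S k b y≢x)))
      (∨-step c b (any-⊎ ks (λ j → setAt-true _≟V'_ S (x , k) b (x , j)))
        ∘ subst (λ s → c ∨ (s ∨ any (λ j → setAt _≟V'_ S (x , k) b (x , j)) ks) ≡ true) (setAt-same _≟V'_ S (x , k) b))

    dominated-step : ∀ c k ks H b → Dominated c (k ∷ ks) H → Dominated (c ∨ b) ks (λ S → H (setAt _≟V'_ S (x , k) b))
    dominated-step c k ks H b dom S = ≤-trans (dom _) (g-mono _ _ (expose-copy-⊆ S k b c ks))

    block-present : ∀ ks {H} → Dominated true ks H → I′ (map (x ,_) ks ++ L) H ≤ R true
    block-present []       dom = ih g[x≔ true ] (g[x≔]-mono true) _ dom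
    block-present (k ∷ ks) {H} dom = begin
      I′ (map (x ,_) (k ∷ ks) ++ L) H
        ≤⟨ convex-mono 0≤u u≤1 (block-present ks (dominated-step true k ks H true dom)) (block-present ks (dominated-step true k ks H false dom)) ⟩
      u * R true + (1ℚ - u) * R true
        ≡⟨ solve 2 (λ a r → a :* r :+ (con 1ℚ :- a) :* r := r) refl u (R true) ⟩
      R true ∎
      where open ≤-Reasoning

    block-absent : ∀ ks {H} → Dominated false ks H → I′ (map (x ,_) ks ++ L) H ≤ R false + fromℕ (length ks) * u * (R true - R false)
    block-absent [] {H} dom = begin
      I′ L H                 ≤⟨ ih g[x≔ false ] (g[x≔]-mono false) _ dom ⟩
      R false                ≡⟨ solve 3 (λ r a d → r := r :+ con 0ℚ :* a :* d) refl (R false) u (R true - R false) ⟩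
      R false + 0ℚ * u * (R true - R false) ∎
      where open ≤-Reasoning
    block-absent (k ∷ ks) {H} dom = begin
      I′ (map (x ,_) (k ∷ ks) ++ L) H
        ≤⟨ convex-mono 0≤u u≤1 (block-present ks (dominated-step false k ks H true dom)) (block-absent ks (dominated-step false k ks H false dom)) ⟩
      u * R true + (1ℚ - u) * (R false + t * u * (R true - R false))
        ≤⟨ p≤p+q _ (0≤p*q (0≤p*q (0≤p*q (0≤fromℕ (length ks)) 0≤u) 0≤u) 0≤R₁-R₀) ⟩
      u * R true + (1ℚ - u) * (R false + t * u * (R true - R false)) + t * u * u * (R true - R false)
        ≡⟨ solve 4 (λ a r₁ r₀ t → a :* r₁ :+ (con 1ℚ :- a) :* (r₀ :+ t :* a :* (r₁ :- r₀)) :+ t :* a :* a :* (r₁ :- r₀)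
                     := r₀ :+ (con 1ℚ :+ t) :* a :* (r₁ :- r₀)) refl u (R true) (R false) t ⟩
      R false + (1ℚ + t) * u * (R true - R false)
        ≡⟨ cong (λ z → R false + z * u * (R true - R false)) (sym (fromℕ-suc (length ks))) ⟩
      R false + fromℕ (length (k ∷ ks)) * u * (R true - R false) ∎
      where
      t = fromℕ (length ks)
      open ≤-Reasoning

  -- Only H ≤ g ∘ Π (not H = g ∘ Π) survives conditioning on individual copies.
  split-bound : ∀ xs g → NonDecreasing g → ∀ H → (∀ S → H S ≤ g (Π S)) → I′ (concatMap copies xs) H ≤ I xs g
  split-bound []       g g-mono H H≤gΠ = ≤-trans (H≤gΠ _) (g-mono _ _ Π∅⊆∅)
    where
    Π∅⊆∅ : Π {m} {n} (λ _ → false) ⊆ (λ _ → false)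
    Π∅⊆∅ i = trans (sym (any-false (allFin (n i))))
  split-bound (x ∷ xs) g g-mono H H≤gΠ = begin
    I′ (concatMap copies (x ∷ xs)) H
      ≤⟨ block-absent (allFin (n x)) (λ S → ≤-trans (H≤gΠ S) (g-mono _ _ (⊆-setAt-self _≟F_ (Π S) x))) ⟩
    R false + fromℕ (length (allFin (n x))) * u * (R true - R false)
      ≡⟨ cong (λ j → R false + fromℕ j * u * (R true - R false)) (length-tabulate id) ⟩
    R false + fromℕ (n x) * u * (R true - R false)
      ≡⟨ cong (λ z → R false + z * (R true - R false)) (fromℕ*share (n x) (p x)) ⟩
    R false + p x * (R true - R false)
      ≡⟨ solve 3 (λ a r₁ r₀ → r₀ :+ a :* (r₁ :- r₀) := a :* r₁ :+ (con 1ℚ :- a) :* r₀) refl (p x) (R true) (R false) ⟩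
    I (x ∷ xs) g ∎
    where
    open Block g g-mono x xs (concatMap copies xs) (split-bound xs)
    open ≤-Reasoning

mainTheorem9 : (m : ℕ) (f : Subset (Fin m) → ℚ) (p : Fin m → ℚ) (n : Fin m → ℕ)
    → NonDecreasing f
    → (∀ i → 0ℚ ≤ p i) → (∀ i → p i ≤ 1ℚ)
    → (hn : ∀ i → 1 Data.Nat.≤ n i)
    → IV' m n (splitF n f) (splitP n hn p) ≤ IV m f p
mainTheorem9 m f p n f-mono 0≤p p≤1 hn =
  Splitting.split-bound n hn p 0≤p p≤1 (allFin m) f f-mono (splitF n f) (λ _ → ≤-refl)
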